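{- The permutation $\pi_0=(1,2)(3,4)\cdots(2n-1,2n)$ is the unique element of $\tilde{\mathcal{D}}^2_{2n}$ in which all pairs $i<j$ with $2\le i<j\le 2n-1$, $i$ even and $j$ odd, are in non-edge configuration.
   Context: $\mathcal{S}_{2n}$ is the symmetric group on $\{1,\dots,2n\}$. $\tilde{\mathcal{D}}^2_{2n}$ is the set of $\pi\in\mathcal{S}_{2n}$ with $\pi(2i-1)\ge 2i-1$ and $\pi(2i)<2i$ for all $i\in\{1,\dots,n\}$, and $\pi(2i-1)>2i-1$ for all $i\in\{1,\dots,n-1\}$. For $\sigma\in\mathcal{S}_{2n}$ and $2\le i<j\le 2n-1$ with $i$ even and $j$ odd, $i$ and $j$ are in edge configuration in $\sigma$ if ($\sigma^{ -1}(i)<\sigma^{ -1}(j)$ iff $\sigma^{ -1}(i)\equiv\sigma^{ -1}(j)\pmod 2$); otherwise they are in non-edge configuration. -}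

module Defs where

open import Data.Nat using (ℕ; zero; suc; _+_; _*_; _∸_; _≤_; _<_; _%_)
open import Data.Fin using (Fin; toℕ)
open import Data.Fin.Permutation using (Permutation′; _⟨$⟩ʳ_; _⟨$⟩ˡ_)
open import Data.Product using (_×_; Σ)
open import Relation.Binary.PropositionalEquality using (_≡_)
open import Function.Bundles using (_⇔_)
open import Relation.Nullary using (¬_)

Even : ℕ → Set
Even k = k % 2 ≡ 0

Odd : ℕ → Set
Odd k = k % 2 ≡ 1

-- Elements of {1,…,2n} are represented by Fin (2 * n); the element x
-- stands for the number val x = toℕ x + 1.
val : ∀ {m} → Fin m → ℕ
val x = suc (toℕ x)

_⟪_⟫ : ∀ {m} → Permutation′ m → Fin m → ℕ
π ⟪ x ⟫ = val (π ⟨$⟩ʳ x)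

_⁻¹⟪_⟫ : ∀ {m} → Permutation′ m → Fin m → ℕ
σ ⁻¹⟪ x ⟫ = val (σ ⟨$⟩ˡ x)

record InD (n : ℕ) (π : Permutation′ (2 * n)) : Set where
  field
    oddWeak   : ∀ (i : ℕ) (x : Fin (2 * n)) → 1 ≤ i → i ≤ n →
                val x ≡ 2 * i ∸ 1 → 2 * i ∸ 1 ≤ π ⟪ x ⟫
    evenStrict : ∀ (i : ℕ) (x : Fin (2 * n)) → 1 ≤ i → i ≤ n →
                val x ≡ 2 * i → π ⟪ x ⟫ < 2 * i
    oddStrict : ∀ (i : ℕ) (x : Fin (2 * n)) → 1 ≤ i → i ≤ n ∸ 1 →
                val x ≡ 2 * i ∸ 1 → 2 * i ∸ 1 < π ⟪ x ⟫

EdgeConfig : ∀ {m} → Permutation′ m → Fin m → Fin m → Set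
EdgeConfig σ a b = (σ ⁻¹⟪ a ⟫ < σ ⁻¹⟪ b ⟫) ⇔ (σ ⁻¹⟪ a ⟫ % 2 ≡ σ ⁻¹⟪ b ⟫ % 2)

NonEdgeConfig : ∀ {m} → Permutation′ m → Fin m → Fin m → Set
NonEdgeConfig σ a b = ¬ EdgeConfig σ a b

AllNonEdge : (n : ℕ) → Permutation′ (2 * n) → Set
AllNonEdge n σ = ∀ (a b : Fin (2 * n)) → 2 ≤ val a → val a < val b →
  val b ≤ 2 * n ∸ 1 → Even (val a) → Odd (val b) → NonEdgeConfig σ a b

IsPi0 : (n : ℕ) → Permutation′ (2 * n) → Set
IsPi0 n π = ∀ (x : Fin (2 * n)) →
  (Odd (val x) → π ⟪ x ⟫ ≡ suc (val x)) × (Even (val x) → π ⟪ x ⟫ ≡ val x ∸ 1)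

module Submission where

-- Seen from the values, membership in D̃² says that a value at an odd position
-- lies at or above it and a value at an even position lies strictly below it.
-- The non-edge condition forbids an even value i at an even position p: the odd
-- value p − 1 > i would be in edge configuration with i wherever it sits.
-- Hence both π and π⁻¹ send every even point to a smaller odd value, and an
-- upward induction forces π(2k) = 2k − 1 and π⁻¹(2k) = 2k − 1, i.e. π = π₀.
-- Conversely π₀ works since π₀⁻¹(i) = i − 1 is odd and π₀⁻¹(j) = j + 1 is even.

open import Data.Nat using (ℕ; zero; suc; _+_; _*_; _∸_; _≤_; _<_; _%_; z≤n; s≤s; s≤s⁻¹; pred)
open import Data.Nat.Properties
  using (≤-refl; ≤-trans; <-trans; <-irrefl; <-asym; ≤-<-trans; <⇒≤; ≤∧≢⇒<;
         m≤n⇒m<n∨m≡n; suc-injective; +-suc; *-cancelˡ-≤; <⇒≤pred; pred[m∸n]≡m∸[1+n])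
open import Data.Fin using (Fin; toℕ; fromℕ<)
import Data.Fin.Base as Fin
open import Data.Fin.Properties using (toℕ-injective; toℕ-fromℕ<; toℕ<n)
open import Data.Fin.Induction using (<-wellFounded)
open import Data.Fin.Permutation
  using (Permutation′; _⟨$⟩ʳ_; _⟨$⟩ˡ_; permutation; inverseˡ; inverseʳ; flip)
open import Induction.WellFounded using (Acc; acc)
open import Data.Product using (_×_; Σ; _,_; proj₁; proj₂)
open import Data.Sum using (_⊎_; inj₁; inj₂)
open import Data.Empty using (⊥; ⊥-elim)
open import Relation.Binary.PropositionalEquality
open import Function.Bundles using (mk⇔; Equivalence)

open import Defs

even⊎odd : ∀ k → Even k ⊎ Odd k
even⊎odd zero          = inj₁ refl
even⊎odd (suc zero)    = inj₂ refl
even⊎odd (suc (suc k)) = even⊎odd k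

even∧odd⇒⊥ : ∀ {k} → Even k → Odd k → ⊥
even∧odd⇒⊥ e o with trans (sym e) o
... | ()

even⇒odd-suc : ∀ k → Even k → Odd (suc k)
even⇒odd-suc zero          e = refl
even⇒odd-suc (suc (suc k)) e = even⇒odd-suc k e

odd⇒even-suc : ∀ k → Odd k → Even (suc k)
odd⇒even-suc (suc zero)    o = refl
odd⇒even-suc (suc (suc k)) o = odd⇒even-suc k o

even-suc⇒odd : ∀ k → Even (suc k) → Odd k
even-suc⇒odd (suc zero)    e = refl
even-suc⇒odd (suc (suc k)) e = even-suc⇒odd k e

odd-suc⇒even : ∀ k → Odd (suc k) → Even k
odd-suc⇒even zero          o = refl
odd-suc⇒even (suc (suc k)) o = odd-suc⇒even k o

even-suc⇒2≤ : ∀ k → Even (suc k) → 2 ≤ suc k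
even-suc⇒2≤ (suc k) e = s≤s (s≤s z≤n)

same-parity-<⇒suc< : ∀ a b → a % 2 ≡ b % 2 → a < b → suc a < b
same-parity-<⇒suc< zero          (suc (suc b)) eq lt                 = s≤s (s≤s z≤n)
same-parity-<⇒suc< (suc zero)    (suc (suc (suc b))) eq lt           = s≤s (s≤s (s≤s z≤n))
same-parity-<⇒suc< (suc (suc a)) (suc (suc b)) eq (s≤s (s≤s lt)) =
  s≤s (s≤s (same-parity-<⇒suc< a b eq lt))
same-parity-<⇒suc< zero          (suc zero)       () lt
same-parity-<⇒suc< (suc zero)    (suc (suc zero)) () lt
same-parity-<⇒suc< (suc zero)    (suc zero)       eq (s≤s ())

odd≤even⇒< : ∀ {a b} → Odd a → Even b → a ≤ b → a < b
odd≤even⇒< {a} oa eb a≤b = ≤∧≢⇒< a≤b (λ a≡b → even∧odd⇒⊥ {a} (subst Even (sym a≡b) eb) oa)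

double-suc : ∀ i → 2 * suc i ≡ suc (suc (2 * i))
double-suc i = cong suc (+-suc i (i + 0))

even-double : ∀ i → Even (2 * i)
even-double zero    = refl
even-double (suc i) = subst Even (sym (double-suc i)) (even-double i)

odd-double-pred : ∀ i → 1 ≤ i → Odd (2 * i ∸ 1)
odd-double-pred (suc i) _ =
  subst (λ k → Odd (k ∸ 1)) (sym (double-suc i)) (even⇒odd-suc (2 * i) (even-double i))

half : ∀ k → Even k → Σ ℕ λ i → 2 * i ≡ k
half zero          e = 0 , refl
half (suc (suc k)) e with half k e
... | i , 2i≡k = suc i , trans (double-suc i) (cong (λ j → suc (suc j)) 2i≡k)

double≡suc⇒1≤ : ∀ i {k} → 2 * i ≡ suc k → 1 ≤ i
double≡suc⇒1≤ (suc i) _ = s≤s z≤n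

val-injective : ∀ {m} {x y : Fin m} → val x ≡ val y → x ≡ y
val-injective eq = toℕ-injective (suc-injective eq)

val-fromℕ< : ∀ {m k} (k<m : k < m) → val (fromℕ< k<m) ≡ suc k
val-fromℕ< k<m = cong suc (toℕ-fromℕ< k<m)

val-surjective : ∀ {m} w → 0 < w → w ≤ m → Σ (Fin m) λ y → val y ≡ w
val-surjective (suc k) _ k<m = fromℕ< k<m , val-fromℕ< k<m

⟪⟫-injective : ∀ {m} (σ : Permutation′ m) {x y : Fin m} → σ ⟪ x ⟫ ≡ σ ⟪ y ⟫ → x ≡ y
⟪⟫-injective σ {x} {y} eq = begin
  x                        ≡⟨ inverseˡ σ ⟨
  σ ⟨$⟩ˡ (σ ⟨$⟩ʳ x)        ≡⟨ cong (σ ⟨$⟩ˡ_) (val-injective eq) ⟩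
  σ ⟨$⟩ˡ (σ ⟨$⟩ʳ y)        ≡⟨ inverseˡ σ ⟩
  y                        ∎
  where open ≡-Reasoning

⟪⁻¹⟫-inverse : ∀ {m} (σ : Permutation′ m) (v : Fin m) → σ ⟪ σ ⟨$⟩ˡ v ⟫ ≡ val v
⟪⁻¹⟫-inverse σ v = cong val (inverseʳ σ)

-- If every even point is sent to a smaller odd value, strong induction on the
-- point shows it is sent to its predecessor: a larger gap would leave the even
-- point σ(x)+1 < x to be sent to σ(x) as well.
module _ {m} (σ : Permutation′ m)
         (odd-at-even   : ∀ x → Even (val x) → Odd (σ ⟪ x ⟫))
         (below-at-even : ∀ x → Even (val x) → σ ⟪ x ⟫ < val x) where

  predecessor-at-even : ∀ x → Even (val x) → σ ⟪ x ⟫ ≡ val x ∸ 1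
  predecessor-at-even x = go x (<-wellFounded x)
    where
    go : ∀ x → Acc Fin._<_ x → Even (val x) → σ ⟪ x ⟫ ≡ val x ∸ 1
    go x (acc rec) ex with m≤n⇒m<n∨m≡n (below-at-even x ex)
    ... | inj₂ eq = cong pred eq
    ... | inj₁ gap = ⊥-elim (<-irrefl (cong toℕ (⟪⟫-injective σ σy≡σx)) y<x)
      where
      σx<x : σ ⟪ x ⟫ < toℕ x
      σx<x = s≤s⁻¹ gap
      σx<m : σ ⟪ x ⟫ < m
      σx<m = <-trans σx<x (toℕ<n x)
      y : Fin m
      y = fromℕ< σx<m
      vy : val y ≡ suc (σ ⟪ x ⟫)
      vy = val-fromℕ< σx<m
      y<x : toℕ y < toℕ x
      y<x = subst (_< toℕ x) (sym (toℕ-fromℕ< σx<m)) σx<x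
      ey : Even (val y)
      ey = subst Even (sym vy) (odd⇒even-suc (σ ⟪ x ⟫) (odd-at-even x ex))
      σy≡σx : σ ⟪ y ⟫ ≡ σ ⟪ x ⟫
      σy≡σx = trans (go y (rec y<x) ey) (cong (_∸ 1) vy)

odd-val<2n : ∀ n (x : Fin (2 * n)) → Odd (val x) → val x < 2 * n
odd-val<2n n x o = odd≤even⇒< o (even-double n) (toℕ<n x)

module _ {n} {π : Permutation′ (2 * n)} (D : InD n π) where

  InD-odd : ∀ x → Odd (val x) → val x ≤ π ⟪ x ⟫
  InD-odd x o with half (suc (val x)) (odd⇒even-suc (val x) o)
  ... | i , 2i≡1+x = subst (_≤ π ⟪ x ⟫) (sym x≡2i-1)
      (InD.oddWeak D i x (double≡suc⇒1≤ i 2i≡1+x) i≤n x≡2i-1)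
    where
    x≡2i-1 : val x ≡ 2 * i ∸ 1
    x≡2i-1 = cong (_∸ 1) (sym 2i≡1+x)
    i≤n : i ≤ n
    i≤n = *-cancelˡ-≤ 2 (subst (_≤ 2 * n) (sym 2i≡1+x) (odd-val<2n n x o))

  InD-even : ∀ x → Even (val x) → π ⟪ x ⟫ < val x
  InD-even x e with half (val x) e
  ... | i , 2i≡x = subst (π ⟪ x ⟫ <_) 2i≡x
      (InD.evenStrict D i x (double≡suc⇒1≤ i 2i≡x) i≤n (sym 2i≡x))
    where
    i≤n : i ≤ n
    i≤n = *-cancelˡ-≤ 2 (subst (_≤ 2 * n) (sym 2i≡x) (toℕ<n x))

  InD-odd-position : ∀ v → Odd (π ⁻¹⟪ v ⟫) → π ⁻¹⟪ v ⟫ ≤ val v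
  InD-odd-position v o = subst (π ⁻¹⟪ v ⟫ ≤_) (⟪⁻¹⟫-inverse π v) (InD-odd (π ⟨$⟩ˡ v) o)

  InD-even-position : ∀ v → Even (π ⁻¹⟪ v ⟫) → val v < π ⁻¹⟪ v ⟫
  InD-even-position v e = subst (_< π ⁻¹⟪ v ⟫) (⟪⁻¹⟫-inverse π v) (InD-even (π ⟨$⟩ˡ v) e)

  -- If an even value i sat at an even position, the odd value j just below that
  -- position is larger than i, and wherever j sits the pair (i, j) is in edge
  -- configuration.
  even-value-at-odd-position : AllNonEdge n π → ∀ i → Even (val i) → Odd (π ⁻¹⟪ i ⟫)
  even-value-at-odd-position NE i ei with even⊎odd (π ⁻¹⟪ i ⟫)
  ... | inj₂ o = o
  ... | inj₁ e = ⊥-elim (NE i j (even-suc⇒2≤ (toℕ i) ei) i<j j≤2n-1 ei oj edge)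
    where
    gap : suc (val i) < π ⁻¹⟪ i ⟫
    gap = same-parity-<⇒suc< (val i) (π ⁻¹⟪ i ⟫) (trans ei (sym e)) (InD-even-position i e)
    i<j-pos : val i < toℕ (π ⟨$⟩ˡ i)
    i<j-pos = s≤s⁻¹ gap
    j-val : Σ (Fin (2 * n)) λ j → val j ≡ toℕ (π ⟨$⟩ˡ i)
    j-val = val-surjective _ (≤-<-trans z≤n i<j-pos) (<⇒≤ (toℕ<n (π ⟨$⟩ˡ i)))
    j = proj₁ j-val
    vj = proj₂ j-val
    i<j : val i < val j
    i<j = subst (val i <_) (sym vj) i<j-pos
    oj : Odd (val j)
    oj = subst Odd (sym vj) (even-suc⇒odd (toℕ (π ⟨$⟩ˡ i)) e)
    j≤2n-1 : val j ≤ 2 * n ∸ 1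
    j≤2n-1 = subst (val j ≤_) (pred[m∸n]≡m∸[1+n] (2 * n) 0) (<⇒≤pred (odd-val<2n n j oj))
    edge : EdgeConfig π i j
    edge with even⊎odd (π ⁻¹⟪ j ⟫)
    ... | inj₁ ej = mk⇔ (λ _ → trans e (sym ej)) (λ _ → ≤∧≢⇒< pi≤pj pi≢pj)
      where
      pi≤pj : π ⁻¹⟪ i ⟫ ≤ π ⁻¹⟪ j ⟫
      pi≤pj = subst (_≤ π ⁻¹⟪ j ⟫) (cong suc vj) (InD-even-position j ej)
      pi≢pj : π ⁻¹⟪ i ⟫ ≢ π ⁻¹⟪ j ⟫
      pi≢pj pi≡pj = <-irrefl (cong val (⟪⟫-injective (flip π) pi≡pj)) i<j
    ... | inj₂ oj′ = mk⇔ (λ pi<pj → ⊥-elim (<-asym pi<pj pj<pi))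
                         (λ same → ⊥-elim (even∧odd⇒⊥ {π ⁻¹⟪ j ⟫} (trans (sym same) e) oj′))
      where
      pj<pi : π ⁻¹⟪ j ⟫ < π ⁻¹⟪ i ⟫
      pj<pi = ≤-<-trans (InD-odd-position j oj′) (subst (_< π ⁻¹⟪ i ⟫) (sym vj) ≤-refl)

InD∧AllNonEdge⇒IsPi0 : ∀ n (π : Permutation′ (2 * n)) → InD n π → AllNonEdge n π → IsPi0 n π
InD∧AllNonEdge⇒IsPi0 n π D NE x = π-at-odd , predecessor-at-even π odd-at-even (InD-even D) x
  where
  even-at-odd : ∀ v → Even (val v) → Odd (π ⁻¹⟪ v ⟫)
  even-at-odd = even-value-at-odd-position D NE

  odd-at-even : ∀ y → Even (val y) → Odd (π ⟪ y ⟫)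
  odd-at-even y ey with even⊎odd (π ⟪ y ⟫)
  ... | inj₂ o = o
  ... | inj₁ e = ⊥-elim (even∧odd⇒⊥ {val y} ey
                   (subst (λ z → Odd (val z)) (inverseˡ π) (even-at-odd (π ⟨$⟩ʳ y) e)))

  position-below : ∀ v → Even (val v) → π ⁻¹⟪ v ⟫ < val v
  position-below v ev = odd≤even⇒< (even-at-odd v ev) ev (InD-odd-position D v (even-at-odd v ev))

  π-at-odd : Odd (val x) → π ⟪ x ⟫ ≡ suc (val x)
  π-at-odd ox = begin
    π ⟪ x ⟫              ≡⟨ cong (π ⟪_⟫) x≡π⁻¹v ⟩
    π ⟪ π ⟨$⟩ˡ v ⟫       ≡⟨ ⟪⁻¹⟫-inverse π v ⟩
    val v                ≡⟨ vv ⟩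
    suc (val x)          ∎
    where
    open ≡-Reasoning
    v-val = val-surjective (suc (val x)) (s≤s z≤n) (odd-val<2n n x ox)
    v = proj₁ v-val
    vv = proj₂ v-val
    x≡π⁻¹v : x ≡ π ⟨$⟩ˡ v
    x≡π⁻¹v = val-injective (sym (trans
      (predecessor-at-even (flip π) even-at-odd position-below v
        (subst Even (sym vv) (odd⇒even-suc (val x) ox)))
      (cong (_∸ 1) vv)))

IsPi0⇒InD : ∀ n (π : Permutation′ (2 * n)) → IsPi0 n π → InD n π
IsPi0⇒InD n π pi0 = record
  { oddWeak    = λ i x 1≤i _ x≡ → subst (_≤ π ⟪ x ⟫) x≡ (<⇒≤ (π-at-odd i x 1≤i x≡))
  ; evenStrict = λ i x _ _ x≡ → subst (π ⟪ x ⟫ <_) x≡ (subst (_< val x) (sym (π-at-even i x x≡)) ≤-refl)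
  ; oddStrict  = λ i x 1≤i _ x≡ → subst (_< π ⟪ x ⟫) x≡ (π-at-odd i x 1≤i x≡)
  }
  where
  π-at-odd : ∀ i x → 1 ≤ i → val x ≡ 2 * i ∸ 1 → val x < π ⟪ x ⟫
  π-at-odd i x 1≤i x≡ = subst (val x <_)
    (sym (proj₁ (pi0 x) (subst Odd (sym x≡) (odd-double-pred i 1≤i)))) ≤-refl
  π-at-even : ∀ i x → val x ≡ 2 * i → π ⟪ x ⟫ ≡ val x ∸ 1
  π-at-even i x x≡ = proj₂ (pi0 x) (subst Even (sym x≡) (even-double i))

swapPair : ℕ → ℕ
swapPair zero          = 1
swapPair (suc zero)    = 0
swapPair (suc (suc k)) = suc (suc (swapPair k))

swapPair-involutive : ∀ k → swapPair (swapPair k) ≡ k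
swapPair-involutive zero          = refl
swapPair-involutive (suc zero)    = refl
swapPair-involutive (suc (suc k)) = cong (λ j → suc (suc j)) (swapPair-involutive k)

swapPair-< : ∀ {k M} → Even M → k < M → swapPair k < M
swapPair-< {zero}          {M}           e lt                 = same-parity-<⇒suc< 0 M (sym e) lt
swapPair-< {suc zero}      {M}           e lt                 = ≤-trans (s≤s z≤n) lt
swapPair-< {suc (suc k)}   {suc (suc M)} e (s≤s (s≤s lt)) = s≤s (s≤s (swapPair-< e lt))

swapPair-even : ∀ k → Even k → swapPair k ≡ suc k
swapPair-even zero          e = refl
swapPair-even (suc (suc k)) e = cong (λ j → suc (suc j)) (swapPair-even k e)

swapPair-odd : ∀ k → Odd k → suc (swapPair k) ≡ k
swapPair-odd (suc zero)    o = refl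
swapPair-odd (suc (suc k)) o = cong (λ j → suc (suc j)) (swapPair-odd k o)

module _ (n : ℕ) where

  swapPair<2n : ∀ (x : Fin (2 * n)) → swapPair (toℕ x) < 2 * n
  swapPair<2n x = swapPair-< (even-double n) (toℕ<n x)

  swapPairFin : Fin (2 * n) → Fin (2 * n)
  swapPairFin x = fromℕ< (swapPair<2n x)

  val-swapPairFin : ∀ x → val (swapPairFin x) ≡ suc (swapPair (toℕ x))
  val-swapPairFin x = val-fromℕ< (swapPair<2n x)

  swapPairFin-involutive : ∀ x → swapPairFin (swapPairFin x) ≡ x
  swapPairFin-involutive x = toℕ-injective (begin
    toℕ (swapPairFin (swapPairFin x))  ≡⟨ toℕ-fromℕ< (swapPair<2n (swapPairFin x)) ⟩
    swapPair (toℕ (swapPairFin x))     ≡⟨ cong swapPair (toℕ-fromℕ< (swapPair<2n x)) ⟩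
    swapPair (swapPair (toℕ x))        ≡⟨ swapPair-involutive (toℕ x) ⟩
    toℕ x                              ∎)
    where open ≡-Reasoning

  π₀ : Permutation′ (2 * n)
  π₀ = permutation swapPairFin swapPairFin swapPairFin-involutive swapPairFin-involutive

  π₀-isPi0 : IsPi0 n π₀
  π₀-isPi0 x =
      (λ o → trans (val-swapPairFin x) (cong suc (swapPair-even (toℕ x) (odd-suc⇒even (toℕ x) o))))
    , (λ e → trans (val-swapPairFin x) (swapPair-odd (toℕ x) (even-suc⇒odd (toℕ x) e)))

  -- π₀ is built as its own inverse, so π₀ ⁻¹⟪ v ⟫ and π₀ ⟪ v ⟫ agree definitionally.
  π₀-allNonEdge : AllNonEdge n π₀
  π₀-allNonEdge a b _ a<b _ ea ob edge =
    even∧odd⇒⊥ {π₀ ⁻¹⟪ a ⟫} (trans (Equivalence.to edge pa<pb) pb-even) pa-odd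
    where
    pa≡ : π₀ ⁻¹⟪ a ⟫ ≡ toℕ a
    pa≡ = proj₂ (π₀-isPi0 a) ea
    pb≡ : π₀ ⁻¹⟪ b ⟫ ≡ suc (val b)
    pb≡ = proj₁ (π₀-isPi0 b) ob
    pa<pb : π₀ ⁻¹⟪ a ⟫ < π₀ ⁻¹⟪ b ⟫
    pa<pb = subst₂ _<_ (sym pa≡) (sym pb≡) (<-trans (<-trans ≤-refl a<b) ≤-refl)
    pa-odd : Odd (π₀ ⁻¹⟪ a ⟫)
    pa-odd = subst Odd (sym pa≡) (even-suc⇒odd (toℕ a) ea)
    pb-even : Even (π₀ ⁻¹⟪ b ⟫)
    pb-even = subst Even (sym pb≡) (odd⇒even-suc (val b) ob)

mainTheorem11 : (n : ℕ) →
    Σ (Permutation′ (2 * n)) (λ π → IsPi0 n π × InD n π × AllNonEdge n π)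
    × (∀ (π : Permutation′ (2 * n)) → InD n π → AllNonEdge n π → IsPi0 n π)
mainTheorem11 n =
    (π₀ n , π₀-isPi0 n , IsPi0⇒InD n (π₀ n) (π₀-isPi0 n) , π₀-allNonEdge n)
  , InD∧AllNonEdge⇒IsPi0 n
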